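{- Let $(X,\mathcal{T})$ be a topological space and $i$ an initial interpretation. Let $\phi$ be a formula and $\mathcal{F}$ a finite family of opens which is a stable splitting for $\phi$ and for each subformula of $\phi$, and assume $X\in\mathcal{F}$. Then for all $U\in\mathcal{F}$, all $x\in U$, and all subformulae $\psi$ of $\phi$: $x,U\models_{\mathcal{T}}\psi$ iff $x,U\models_{\mathcal{F}}\psi$.
   Context: Formulas are built from a countable set $\mathsf{A}$ of atomic formulas (containing $\top,\bot$) by $\land,\neg,\Box,\mathsf{K}$; $i:\mathsf{A}\to\mathcal{P}(X)$ with $i(\top)=X$, $i(\bot)=\emptyset$. For $\mathcal{O}\subseteq\mathcal{P}(X)$, $\models_{\mathcal{O}}$ is satisfaction in $\langle X,\mathcal{O},i\rangle$, defined on pairs $(x,U)$ with $U\in\mathcal{O}$, $x\in U$: $x,U\models A$ iff $x\in i(A)$; Boolean connectives as usual; $x,U\models\mathsf{K}\phi$ iff $y,U\models\phi$ for all $y\in U$; $x,U\models\Box\phi$ iff $x,V\models\phi$ for all $V\in\mathcal{O}$ with $V\subseteq U$, $x\in V$. For $U\in\mathcal{T}$, ${\downarrow}U=\{V\in\mathcal{T}:V\subseteq U\}$. For a finite family $\mathcal{F}$ of opens, $\mathrm{Rem}_{\mathcal{F}}(U_k)={\downarrow}U_k-\bigcup_{U_i\in\mathcal{F},\,U_k\not\subseteq U_i}{\downarrow}U_i$. A finite splitting is a finite family of opens closed under intersection. A set $\mathcal{G}$ of opens is stable for $\phi$ if for every $x$, either $x,V\models_{\mathcal{T}}\phi$ for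 all $V\in\mathcal{G}$ with $x\in V$, or $x,V\models_{\mathcal{T}}\neg\phi$ for all such $V$. A finite splitting is a stable splitting for $\phi$ if each of its remainders is stable for $\phi$. -}

module Defs where

open import Level using (Level; _⊔_) renaming (zero to 0ℓ; suc to lsuc)
open import Data.Nat using (ℕ)
open import Data.Product using (Σ; _×_; _,_; ∃-syntax)
open import Data.Sum using (_⊎_)
open import Data.Empty using (⊥)
open import Data.Unit using (⊤)
open import Data.List using (List)
open import Data.List.Relation.Unary.All using (All)
open import Data.List.Membership.Propositional using (_∈_)
open import Relation.Nullary using (¬_)
open import Relation.Unary using (Pred; _⊆_; _≐_; _∩_; ∅; U)

Subset : Set → Set₁
Subset X = Pred X 0ℓ

⋃ᵢ : {X : Set} (I : Set) → (I → Subset X) → Subset X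
⋃ᵢ I F x = Σ I λ j → F j x

record Topology (X : Set) : Set₁ where
  field
    Open      : Subset X → Set
    Open-ext  : ∀ {V W} → V ≐ W → Open V → Open W
    Open-full : Open U
    Open-∩    : ∀ {V W} → Open V → Open W → Open (V ∩ W)
    Open-⋃    : (I : Set) (F : I → Subset X) → (∀ j → Open (F j)) → Open (⋃ᵢ I F)

data Formula : Set where
  top  : Formula
  bot  : Formula
  atom : ℕ → Formula
  _∧f_ : Formula → Formula → Formula
  ¬f_  : Formula → Formula
  □f_  : Formula → Formula
  Kf_  : Formula → Formula

data _≼_ : Formula → Formula → Set where
  ≼-refl : ∀ {φ} → φ ≼ φ
  ≼-∧ˡ   : ∀ {ψ φ χ} → ψ ≼ φ → ψ ≼ (φ ∧f χ)
  ≼-∧ʳ   : ∀ {ψ φ χ} → ψ ≼ χ → ψ ≼ (φ ∧f χ)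
  ≼-¬    : ∀ {ψ φ} → ψ ≼ φ → ψ ≼ (¬f φ)
  ≼-□    : ∀ {ψ φ} → ψ ≼ φ → ψ ≼ (□f φ)
  ≼-K    : ∀ {ψ φ} → ψ ≼ φ → ψ ≼ (Kf φ)

-- Satisfaction x,U ⊨_𝒪 φ in ⟨X,𝒪,i⟩ (i interprets the atoms atom n;
-- i(⊤) = X and i(⊥) = ∅ are built in). Meaningful for 𝒪 U, U x.
Sat : {ℓ : Level} {X : Set} (𝒪 : Subset X → Set ℓ) (i : ℕ → Subset X) →
      X → Subset X → Formula → Set (lsuc 0ℓ ⊔ ℓ)
Sat 𝒪 i x V top      = Level.Lift _ ⊤
Sat 𝒪 i x V bot      = Level.Lift _ ⊥
Sat 𝒪 i x V (atom n) = Level.Lift _ (i n x)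
Sat 𝒪 i x V (φ ∧f ψ) = Sat 𝒪 i x V φ × Sat 𝒪 i x V ψ
Sat 𝒪 i x V (¬f φ)   = ¬ Sat 𝒪 i x V φ
Sat 𝒪 i x V (Kf φ)   = ∀ y → V y → Sat 𝒪 i y V φ
Sat 𝒪 i x V (□f φ)   = ∀ W → 𝒪 W → W ⊆ V → W x → Sat 𝒪 i x W φ

FamOf : {X : Set} → List (Subset X) → Subset X → Set₁
FamOf Fs V = V ∈ Fs

module _ {X : Set} (T : Topology X) (i : ℕ → Subset X) where
  open Topology T

  _,_⊨𝒯_ : X → Subset X → Formula → Set₁
  x , V ⊨𝒯 φ = Sat Open i x V φ

  ↓_ : Subset X → Subset X → Set
  (↓ V) W = Open W × W ⊆ V

  Rem : List (Subset X) → Subset X → Subset X → Set₁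
  Rem Fs Uk V = (↓ Uk) V × (¬ (Σ (Subset X) λ Ui → Ui ∈ Fs × ¬ (Uk ⊆ Ui) × (↓ Ui) V))

  FiniteSplitting : List (Subset X) → Set₁
  FiniteSplitting Fs =
    All Open Fs ×
    (∀ V W → V ∈ Fs → W ∈ Fs → Σ (Subset X) λ Z → Z ∈ Fs × Z ≐ (V ∩ W))

  Stable : (Subset X → Set₁) → Formula → Set₁
  Stable 𝒢 φ = ∀ x →
    (∀ V → 𝒢 V → V x → x , V ⊨𝒯 φ) ⊎ (∀ V → 𝒢 V → V x → x , V ⊨𝒯 (¬f φ))

  StableSplitting : List (Subset X) → Formula → Set₁
  StableSplitting Fs φ = FiniteSplitting Fs × (∀ Uk → Uk ∈ Fs → Stable (Rem Fs Uk) φ)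

{-# OPTIONS --safe #-}

-- A formula is evaluated only at opens below the current one, so the two
-- semantics can differ only at □. Given an open W ⊆ V with V ∈ 𝓕, let Z be
-- the least member of 𝓕 containing W (it exists as 𝓕 is finite and closed
-- under ∩, and Z ⊆ V). Both W and Z lie in Rem(Z), so stability of Rem(Z)
-- transfers the truth value of ψ at Z, which the 𝓕-semantics sees, to W.

module Submission where

open import Defs
open import Level using (lift; lower) renaming (zero to 0ℓ; suc to lsuc)
open import Axiom.ExcludedMiddle using (ExcludedMiddle)
open import Data.Nat using (ℕ)
open import Data.Product using (Σ; _×_; _,_; proj₁; proj₂)
open import Data.Product.Function.NonDependent.Propositional using (_×-⇔_)
open import Data.Sum using (inj₁; inj₂)
open import Data.Empty using (⊥-elim)
open import Data.List using (List; []; _∷_)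
open import Data.List.Relation.Unary.All as All using (All; []; _∷_)
open import Data.List.Relation.Unary.Any using (here; there)
open import Data.List.Membership.Propositional using (_∈_)
open import Function.Base using (id)
open import Function.Bundles using (_⇔_; mk⇔; Equivalence)
open import Function.Construct.Identity using (⇔-id)
open import Function.Related.TypeIsomorphisms using (¬-cong-⇔)
open import Relation.Binary.PropositionalEquality using (refl)
open import Relation.Nullary using (Dec; yes; no; contradiction)
open import Relation.Nullary.Decidable using (map′)
open import Relation.Unary using (_≐_; U; _⊆_; _∩_)

≼-trans : ∀ {ψ φ χ} → ψ ≼ φ → φ ≼ χ → ψ ≼ χ
≼-trans p ≼-refl   = p
≼-trans p (≼-∧ˡ q) = ≼-∧ˡ (≼-trans p q)
≼-trans p (≼-∧ʳ q) = ≼-∧ʳ (≼-trans p q)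
≼-trans p (≼-¬ q)  = ≼-¬ (≼-trans p q)
≼-trans p (≼-□ q)  = ≼-□ (≼-trans p q)
≼-trans p (≼-K q)  = ≼-K (≼-trans p q)

IntersectionClosed : {X : Set} → List (Subset X) → Set₁
IntersectionClosed {X} Fs =
  ∀ V W → V ∈ Fs → W ∈ Fs → Σ (Subset X) λ Z → Z ∈ Fs × Z ≐ (V ∩ W)

module LeastCover (em : ExcludedMiddle (lsuc 0ℓ)) {X : Set} (Fs : List (Subset X))
                  (∩-closed : IntersectionClosed Fs) where

  record LeastCoverAmong (Ls : List (Subset X)) (W : Subset X) : Set₁ where
    constructor leastCover
    field
      cover       : Subset X
      cover∈Fs    : cover ∈ Fs
      ⊆-cover     : W ⊆ cover
      cover-least : ∀ {U} → U ∈ Ls → W ⊆ U → cover ⊆ U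

  _⊆?_ : (W U : Subset X) → Dec (W ⊆ U)
  W ⊆? U = map′ lower lift em

  leastCoverAmong : ∀ {V W} → V ∈ Fs → W ⊆ V →
                    ∀ Ls → All (_∈ Fs) Ls → LeastCoverAmong Ls W
  leastCoverAmong {V = V} V∈Fs W⊆V [] [] = leastCover V V∈Fs W⊆V λ ()
  leastCoverAmong {W = W} V∈Fs W⊆V (U ∷ Ls) (U∈Fs ∷ Ls⊆Fs)
    with leastCoverAmong V∈Fs W⊆V Ls Ls⊆Fs | W ⊆? U
  ... | leastCover Z Z∈Fs W⊆Z least | no W⊈U =
    leastCover Z Z∈Fs W⊆Z λ { (here refl) W⊆U → ⊥-elim (W⊈U W⊆U)
                            ; (there U′∈Ls) → least U′∈Ls }
  ... | leastCover Z Z∈Fs W⊆Z least | yes W⊆U =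
    let (Z∩U , Z∩U∈Fs , Z∩U⊆ , ⊆Z∩U) = ∩-closed Z U Z∈Fs U∈Fs in
    leastCover Z∩U Z∩U∈Fs (λ w → ⊆Z∩U (W⊆Z w , W⊆U w))
      λ { (here refl) _ z → proj₂ (Z∩U⊆ z)
        ; (there U′∈Ls) W⊆U′ z → least U′∈Ls W⊆U′ (proj₁ (Z∩U⊆ z)) }

  leastCoverInFs : ∀ {V W} → V ∈ Fs → W ⊆ V → LeastCoverAmong Fs W
  leastCoverInFs V∈Fs W⊆V = leastCoverAmong V∈Fs W⊆V Fs (All.tabulate id)

module Semantics {X : Set} (T : Topology X) (i : ℕ → Subset X) where
  open Topology T

  least⇒∈Rem : ∀ {Fs W Z} → Open W → W ⊆ Z → (∀ {U} → U ∈ Fs → W ⊆ U → Z ⊆ U) → Rem T i Fs Z W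
  least⇒∈Rem Open-W W⊆Z least =
    (Open-W , W⊆Z) , λ (U , U∈Fs , Z⊈U , _ , W⊆U) → Z⊈U (least U∈Fs W⊆U)

  Agree : List (Subset X) → Formula → Set₁
  Agree Fs ψ = ∀ V → V ∈ Fs → ∀ x → V x → Sat Open i x V ψ ⇔ Sat (FamOf Fs) i x V ψ

  module _ {Fs : List (Subset X)} where
    open Equivalence

    agree-∧ : ∀ {ψ χ} → Agree Fs ψ → Agree Fs χ → Agree Fs (ψ ∧f χ)
    agree-∧ agree-ψ agree-χ V V∈Fs x Vx = agree-ψ V V∈Fs x Vx ×-⇔ agree-χ V V∈Fs x Vx

    agree-¬ : ∀ {ψ} → Agree Fs ψ → Agree Fs (¬f ψ)
    agree-¬ agree-ψ V V∈Fs x Vx = ¬-cong-⇔ (agree-ψ V V∈Fs x Vx)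

    agree-K : ∀ {ψ} → Agree Fs ψ → Agree Fs (Kf ψ)
    agree-K agree-ψ V V∈Fs x Vx = mk⇔
      (λ h y Vy → to   (agree-ψ V V∈Fs y Vy) (h y Vy))
      (λ h y Vy → from (agree-ψ V V∈Fs y Vy) (h y Vy))

    □-restrict : ∀ {ψ} → All Open Fs → Agree Fs ψ →
                 ∀ V x → Sat Open i x V (□f ψ) → Sat (FamOf Fs) i x V (□f ψ)
    □-restrict Fs-open agree-ψ V x h W W∈Fs W⊆V Wx =
      to (agree-ψ W W∈Fs x Wx) (h W (All.lookup Fs-open W∈Fs) W⊆V Wx)

    □-extend : ExcludedMiddle (lsuc 0ℓ) → ∀ {ψ} → StableSplitting T i Fs ψ → Agree Fs ψ →
               ∀ V → V ∈ Fs → ∀ x → Sat (FamOf Fs) i x V (□f ψ) → Sat Open i x V (□f ψ)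
    □-extend em ((Fs-open , ∩-closed) , stable) agree-ψ V V∈Fs x h W Open-W W⊆V Wx
      with LeastCover.leastCoverInFs em Fs ∩-closed V∈Fs W⊆V
    ... | LeastCover.leastCover Z Z∈Fs W⊆Z least
      with stable Z Z∈Fs x
    ... | inj₁ ψ-on-Rem = ψ-on-Rem W (least⇒∈Rem Open-W W⊆Z least) Wx
    ... | inj₂ ¬ψ-on-Rem =
      contradiction (from (agree-ψ Z Z∈Fs x Zx) (h Z Z∈Fs (least V∈Fs W⊆V) Zx))
                    (¬ψ-on-Rem Z (least⇒∈Rem (All.lookup Fs-open Z∈Fs) id λ _ Z⊆U → Z⊆U) Zx)
      where Zx = W⊆Z Wx

    agree-□ : ExcludedMiddle (lsuc 0ℓ) → ∀ {ψ} → StableSplitting T i Fs ψ →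
              Agree Fs ψ → Agree Fs (□f ψ)
    agree-□ em stable-ψ agree-ψ V V∈Fs x _ =
      mk⇔ (□-restrict (proj₁ (proj₁ stable-ψ)) agree-ψ V x)
          (□-extend em stable-ψ agree-ψ V V∈Fs x)

    agree : ExcludedMiddle (lsuc 0ℓ) → ∀ ψ →
            (∀ χ → χ ≼ ψ → StableSplitting T i Fs χ) → Agree Fs ψ
    agree em top      _      _ _ _ _ = ⇔-id _
    agree em bot      _      _ _ _ _ = ⇔-id _
    agree em (atom _) _      _ _ _ _ = ⇔-id _
    agree em (ψ ∧f χ) stable = agree-∧ (agree em ψ λ θ p → stable θ (≼-∧ˡ p))
                                       (agree em χ λ θ p → stable θ (≼-∧ʳ p))
    agree em (¬f ψ)   stable = agree-¬ (agree em ψ λ θ p → stable θ (≼-¬ p))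
    agree em (Kf ψ)   stable = agree-K (agree em ψ λ θ p → stable θ (≼-K p))
    agree em (□f ψ)   stable = agree-□ em (stable ψ (≼-□ ≼-refl))
                                       (agree em ψ λ θ p → stable θ (≼-□ p))

mainTheorem4 : ExcludedMiddle (lsuc 0ℓ) →
    {X : Set} (T : Topology X) (i : ℕ → Subset X) (φ : Formula) (Fs : List (Subset X)) →
    (∀ ψ → ψ ≼ φ → StableSplitting T i Fs ψ) →
    (Σ (Subset X) λ W → W ∈ Fs × W ≐ U) →
    ∀ V → V ∈ Fs → ∀ x → V x → ∀ ψ → ψ ≼ φ →
    (Sat (Topology.Open T) i x V ψ ⇔ Sat (FamOf Fs) i x V ψ)
mainTheorem4 em T i φ Fs stable _ V V∈Fs x Vx ψ ψ≼φ =
  Semantics.agree T i em ψ (λ χ χ≼ψ → stable χ (≼-trans χ≼ψ ψ≼φ)) V V∈Fs x Vx
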